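{- The functor $\mathcal{P}^{\infty}_a:\mathbf{Sets}\to\mathbf{Sets}$ preserves pullbacks along injective morphisms: if $A$ with projections $\pi_B:A\to B$, $\pi_C:A\to C$ is a pullback in $\mathbf{Sets}$ of $f_1:B\to D$ and $g_1:C\to D$ with $g_1$ injective, then $\mathcal{P}^{\infty}_a(A)$ with $\widehat{\pi_B},\widehat{\pi_C}$ is a pullback of $\widehat{f_1}:\mathcal{P}^{\infty}_a(B)\to\mathcal{P}^{\infty}_a(D)$ and $\widehat{g_1}:\mathcal{P}^{\infty}_a(C)\to\mathcal{P}^{\infty}_a(D)$.
   Context: For a set $M$ whose elements are regarded as atoms (urelements, not sets), put $S_0=M$, $S_{k+1}=S_k\cup\mathcal{P}(S_k)$ and $\mathcal{P}^{\infty}_a(M)=\bigcup_{k\ge 0}S_k$. For a function $f:M\to N$, $\widehat f=\mathcal{P}^{\infty}_a(f):\mathcal{P}^{\infty}_a(M)\to\mathcal{P}^{\infty}_a(N)$ is defined recursively by $\widehat f(x)=f(x)$ for $x\in M$ and $\widehat f(x)=\{\widehat f(x')\mid x'\in x\}$ otherwise. -}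

module Defs where

open import Level using (Level; Setω; Lift; lift; _⊔_) renaming (zero to lzero; suc to lsuc)
open import Data.Nat using (ℕ; zero; suc)
open import Data.Sum using (_⊎_; inj₁; inj₂)
open import Data.Product using (Σ; _×_; _,_)
open import Data.Empty using (⊥)
open import Relation.Binary.PropositionalEquality using (_≡_)

lvl : ℕ → Level
lvl zero    = lzero
lvl (suc n) = lsuc (lvl n)

-- A subset of a type X living in Set ℓ, presented as an arbitrary family
-- indexed by a type of the same universe (so every predicate-subset
-- Σ X P is representable; no smallness restriction).
Fam : {ℓ : Level} → Set ℓ → Set (lsuc ℓ)
Fam {ℓ} X = Σ (Set ℓ) (λ I → I → X)

S : Set → (k : ℕ) → Set (lvl k)
S M zero    = M
S M (suc k) = S M k ⊎ Fam (S M k)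

-- Equality of elements of P^∞_a(M) (possibly given at different stages):
-- atoms are equal iff equal in M, sets are equal by extensionality,
-- an atom is never equal to a set.
Eq : {M : Set} {m n : ℕ} → S M m → S M n → Set (lvl m ⊔ lvl n)
Eq {M} {zero}  {zero}  a b = Lift lzero (a ≡ b)
Eq {M} {zero}  {suc n} a (inj₁ y) = Lift (lvl (suc n)) (Eq {M} {zero} {n} a y)
Eq {M} {zero}  {suc n} a (inj₂ _) = Lift (lvl (suc n)) ⊥
Eq {M} {suc m} {n} (inj₁ x) y = Lift (lvl (suc m)) (Eq {M} {m} {n} x y)
Eq {M} {suc m} {zero} (inj₂ _) b = Lift (lvl (suc m)) ⊥
Eq {M} {suc m} {suc n} (inj₂ X) (inj₁ y) = Lift (lvl (suc m) ⊔ lvl (suc n)) (Eq {M} {suc m} {n} (inj₂ X) y)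
Eq {M} {suc m} {suc n} (inj₂ (I , f)) (inj₂ (J , g)) =
  Lift (lvl (suc m) ⊔ lvl (suc n))
    (((i : I) → Σ J (λ j → Eq {M} {m} {n} (f i) (g j))) × ((j : J) → Σ I (λ i → Eq {M} {m} {n} (f i) (g j))))

hat : {M N : Set} (f : M → N) {k : ℕ} → S M k → S N k
hat f {zero}  a               = f a
hat f {suc k} (inj₁ x)        = inj₁ (hat f x)
hat f {suc k} (inj₂ (I , h))  = inj₂ (I , λ i → hat f (h i))

IsPullback : {A B C D : Set} → (A → B) → (A → C) → (B → D) → (C → D) → Set
IsPullback {A} {B} {C} πB πC f g =
  ((a : A) → f (πB a) ≡ g (πC a)) ×
  ((b : B) (c : C) → f b ≡ g c → Σ A (λ a → (πB a ≡ b) × (πC a ≡ c))) ×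
  ((a a' : A) → πB a ≡ πB a' → πC a ≡ πC a' → a ≡ a')

-- The image of (A, πB, πC) under P^∞_a is a pullback of \hat f, \hat g
-- (elements of P^∞_a(X) = ⋃_k S_k are quantified over all stages k).
record IsPullback∞ {A B C D : Set} (πB : A → B) (πC : A → C) (f : B → D) (g : C → D) : Setω where
  field
    commutes : (k : ℕ) (z : S A k) → Eq {D} {k} {k} (hat f (hat πB z)) (hat g (hat πC z))
    exists   : (m n : ℕ) (x : S B m) (y : S C n) → Eq {D} {m} {n} (hat f x) (hat g y) →
               Σ (S A m) (λ z → Eq {B} {m} {m} (hat πB z) x × Eq {C} {m} {n} (hat πC z) y)
    unique   : (k l : ℕ) (z : S A k) (z' : S A l) →
               Eq {B} {k} {l} (hat πB z) (hat πB z') → Eq {C} {k} {l} (hat πC z) (hat πC z') → Eq {A} {k} {l} z z'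

module Submission where

-- The theorem follows: `commutes` is the square lemma; `unique` matches the
-- members of two sets via their B-images and transports the matching to the
-- C-images; `exists` lifts each member of x through the pullback recursively
-- (through the atom-level pullback at the leaves), and uniqueness of partners
-- along \hat g₁ shows that the set of lifts has exactly the C-image y.

open import Defs
open import Level using (lift)
open import Data.Nat using (ℕ; zero; suc)
open import Data.Sum using (inj₁; inj₂)
open import Data.Product using (Σ; _×_; _,_; proj₁; proj₂)
open import Relation.Binary.PropositionalEquality using (_≡_; refl; sym; trans; cong; subst)

module _ {M : Set} where

  Eq-inj₁ʳ : (m n : ℕ) (x : S M m) (y : S M n) → Eq {M} {m} {n} x y → Eq {M} {m} {suc n} x (inj₁ y)
  Eq-inj₁ʳ zero    n x        y e        = lift e
  Eq-inj₁ʳ (suc m) n (inj₁ x) y (lift e) = lift (Eq-inj₁ʳ m n x y e)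
  Eq-inj₁ʳ (suc m) n (inj₂ X) y e        = lift e

  Eq-refl : (k : ℕ) (x : S M k) → Eq {M} {k} {k} x x
  Eq-refl zero    x              = lift refl
  Eq-refl (suc k) (inj₁ x)       = lift (Eq-inj₁ʳ k k x x (Eq-refl k x))
  Eq-refl (suc k) (inj₂ (I , h)) = lift ((λ i → i , Eq-refl k (h i)) , (λ i → i , Eq-refl k (h i)))

  Eq-sym : (m n : ℕ) (x : S M m) (y : S M n) → Eq {M} {m} {n} x y → Eq {M} {n} {m} y x
  Eq-sym zero    zero    x        y        (lift e) = lift (sym e)
  Eq-sym zero    (suc n) x        (inj₁ y) (lift e) = lift (Eq-sym zero n x y e)
  Eq-sym zero    (suc n) x        (inj₂ _) (lift ())
  Eq-sym (suc m) n       (inj₁ x) y        (lift e) = Eq-inj₁ʳ n m y x (Eq-sym m n x y e)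
  Eq-sym (suc m) zero    (inj₂ _) y        (lift ())
  Eq-sym (suc m) (suc n) (inj₂ X) (inj₁ y) (lift e) = lift (Eq-sym (suc m) n (inj₂ X) y e)
  Eq-sym (suc m) (suc n) (inj₂ (I , h)) (inj₂ (J , k)) (lift (h⊆k , k⊆h)) =
    lift ((λ j → let (i , e) = k⊆h j in i , Eq-sym m n (h i) (k j) e) ,
          (λ i → let (j , e) = h⊆k i in j , Eq-sym m n (h i) (k j) e))

  Eq-trans : (m n p : ℕ) (x : S M m) (y : S M n) (z : S M p) →
             Eq {M} {m} {n} x y → Eq {M} {n} {p} y z → Eq {M} {m} {p} x z
  Eq-trans zero    zero    zero    x y z (lift e) (lift e') = lift (trans e e')
  Eq-trans zero    zero    (suc p) x y (inj₁ z) e (lift e') = lift (Eq-trans zero zero p x y z e e')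
  Eq-trans zero    zero    (suc p) x y (inj₂ _) e (lift ())
  Eq-trans zero    (suc n) p x (inj₁ y) z (lift e) (lift e') = Eq-trans zero n p x y z e e'
  Eq-trans zero    (suc n) p x (inj₂ _) z (lift ()) _
  Eq-trans (suc m) n       p (inj₁ x) y z (lift e) e' = lift (Eq-trans m n p x y z e e')
  Eq-trans (suc m) zero    p (inj₂ _) y z (lift ()) _
  Eq-trans (suc m) (suc n) p (inj₂ X) (inj₁ y) z (lift e) (lift e') =
    Eq-trans (suc m) n p (inj₂ X) y z e e'
  Eq-trans (suc m) (suc n) zero    (inj₂ X) (inj₂ Y) z e (lift ())
  Eq-trans (suc m) (suc n) (suc p) (inj₂ X) (inj₂ Y) (inj₁ z) e (lift e') =
    lift (Eq-trans (suc m) (suc n) p (inj₂ X) (inj₂ Y) z e e')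
  Eq-trans (suc m) (suc n) (suc p) (inj₂ (I , h)) (inj₂ (J , k)) (inj₂ (K , l))
           (lift (h⊆k , k⊆h)) (lift (k⊆l , l⊆k)) =
    lift ((λ i → let (j , e) = h⊆k i ; (q , e') = k⊆l j in q , Eq-trans m n p (h i) (k j) (l q) e e') ,
          (λ q → let (j , e') = l⊆k q ; (i , e) = k⊆h j in i , Eq-trans m n p (h i) (k j) (l q) e e'))

module _ {M N : Set} (f : M → N) where

  hat-cong : (m n : ℕ) (x : S M m) (y : S M n) →
             Eq {M} {m} {n} x y → Eq {N} {m} {n} (hat f x) (hat f y)
  hat-cong zero    zero    x        y        (lift e) = lift (cong f e)
  hat-cong zero    (suc n) x        (inj₁ y) (lift e) = lift (hat-cong zero n x y e)
  hat-cong zero    (suc n) x        (inj₂ _) (lift ())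
  hat-cong (suc m) n       (inj₁ x) y        (lift e) = lift (hat-cong m n x y e)
  hat-cong (suc m) zero    (inj₂ _) y        (lift ())
  hat-cong (suc m) (suc n) (inj₂ X) (inj₁ y) (lift e) = lift (hat-cong (suc m) n (inj₂ X) y e)
  hat-cong (suc m) (suc n) (inj₂ (I , h)) (inj₂ (J , k)) (lift (h⊆k , k⊆h)) =
    lift ((λ i → let (j , e) = h⊆k i in j , hat-cong m n (h i) (k j) e) ,
          (λ j → let (i , e) = k⊆h j in i , hat-cong m n (h i) (k j) e))

  hat-reflects : ((c c' : M) → f c ≡ f c' → c ≡ c') →
                 (m n : ℕ) (x : S M m) (y : S M n) →
                 Eq {N} {m} {n} (hat f x) (hat f y) → Eq {M} {m} {n} x y
  hat-reflects inj zero    zero    x        y        (lift e) = lift (inj x y e)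
  hat-reflects inj zero    (suc n) x        (inj₁ y) (lift e) = lift (hat-reflects inj zero n x y e)
  hat-reflects inj zero    (suc n) x        (inj₂ _) (lift ())
  hat-reflects inj (suc m) n       (inj₁ x) y        (lift e) = lift (hat-reflects inj m n x y e)
  hat-reflects inj (suc m) zero    (inj₂ _) y        (lift ())
  hat-reflects inj (suc m) (suc n) (inj₂ X) (inj₁ y) (lift e) =
    lift (hat-reflects inj (suc m) n (inj₂ X) y e)
  hat-reflects inj (suc m) (suc n) (inj₂ (I , h)) (inj₂ (J , k)) (lift (h⊆k , k⊆h)) =
    lift ((λ i → let (j , e) = h⊆k i in j , hat-reflects inj m n (h i) (k j) e) ,
          (λ j → let (i , e) = k⊆h j in i , hat-reflects inj m n (h i) (k j) e))

  atom-preimage : (n : ℕ) (d : N) (y : S M n) → Eq {N} {zero} {n} d (hat f y) →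
                  Σ M (λ c → (d ≡ f c) × Eq {M} {zero} {n} c y)
  atom-preimage zero    d y        (lift e) = y , e , lift refl
  atom-preimage (suc n) d (inj₁ y) (lift e) =
    let (c , d≡fc , c≈y) = atom-preimage n d y e in c , d≡fc , lift c≈y
  atom-preimage (suc n) d (inj₂ _) (lift ())

module _ {B C D : Set} (f : B → D) (g : C → D) (g-inj : (c c' : C) → g c ≡ g c' → c ≡ c') where

  partner-unique : (m m' n n' : ℕ) (x : S B m) (x' : S B m') (y : S C n) (y' : S C n') →
                   Eq {B} {m} {m'} x x' →
                   Eq {D} {m} {n} (hat f x) (hat g y) → Eq {D} {m'} {n'} (hat f x') (hat g y') →
                   Eq {C} {n} {n'} y y'
  partner-unique m m' n n' x x' y y' x≈x' fx≈gy fx'≈gy' =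
    hat-reflects g g-inj n n' y y'
      (Eq-trans n m n' (hat g y) (hat f x) (hat g y')
        (Eq-sym m n (hat f x) (hat g y) fx≈gy)
        (Eq-trans m m' n' (hat f x) (hat f x') (hat g y')
          (hat-cong f m m' x x' x≈x') fx'≈gy'))

module _ {A B C D : Set} (πB : A → B) (πC : A → C) (f : B → D) (g : C → D) where

  hat-square : ((a : A) → f (πB a) ≡ g (πC a)) →
               (k : ℕ) (z : S A k) → Eq {D} {k} {k} (hat f (hat πB z)) (hat g (hat πC z))
  hat-square comm zero    z              = lift (comm z)
  hat-square comm (suc k) (inj₁ z)       =
    lift (Eq-inj₁ʳ k k (hat f (hat πB z)) (hat g (hat πC z)) (hat-square comm k z))
  hat-square comm (suc k) (inj₂ (I , h)) =
    lift ((λ i → i , hat-square comm k (h i)) , (λ i → i , hat-square comm k (h i)))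

  module _ (g-inj : (c c' : C) → g c ≡ g c' → c ≡ c') where

    module _ (comm : (a : A) → f (πB a) ≡ g (πC a))
             (separate : (a a' : A) → πB a ≡ πB a' → πC a ≡ πC a' → a ≡ a') where

      πC-determined : (k l : ℕ) (z : S A k) (z' : S A l) →
                      Eq {B} {k} {l} (hat πB z) (hat πB z') → Eq {C} {k} {l} (hat πC z) (hat πC z')
      πC-determined k l z z' e =
        partner-unique f g g-inj k l k l (hat πB z) (hat πB z') (hat πC z) (hat πC z') e
          (hat-square comm k z) (hat-square comm l z')

      -- For sets, a member matching on
      -- B-images also matches on C-images by πC-determined.
      unique : (k l : ℕ) (z : S A k) (z' : S A l) →
               Eq {B} {k} {l} (hat πB z) (hat πB z') → Eq {C} {k} {l} (hat πC z) (hat πC z') →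
               Eq {A} {k} {l} z z'
      unique zero    zero    z        z'        (lift e) (lift e') = lift (separate z z' e e')
      unique zero    (suc l) z        (inj₁ z') (lift e) (lift e') = lift (unique zero l z z' e e')
      unique zero    (suc l) z        (inj₂ _)  (lift ()) _
      unique (suc k) l       (inj₁ z) z'        (lift e) (lift e') = lift (unique k l z z' e e')
      unique (suc k) zero    (inj₂ _) z'        (lift ()) _
      unique (suc k) (suc l) (inj₂ Z) (inj₁ z') (lift e) (lift e') =
        lift (unique (suc k) l (inj₂ Z) z' e e')
      unique (suc k) (suc l) (inj₂ (I , h)) (inj₂ (J , h')) (lift (h⊆h' , h'⊆h)) _ =
        lift ((λ i → let (j , e) = h⊆h' i in j , unique k l (h i) (h' j) e (πC-determined k l (h i) (h' j) e)) ,
              (λ j → let (i , e) = h'⊆h j in i , unique k l (h i) (h' j) e (πC-determined k l (h i) (h' j) e)))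

    module _ (mediate : (b : B) (c : C) → f b ≡ g c → Σ A (λ a → (πB a ≡ b) × (πC a ≡ c))) where

      -- Atoms are lifted by `mediate`; a set x is lifted member by member,
      -- each member paired with a partner in y.
      exists : (m n : ℕ) (x : S B m) (y : S C n) → Eq {D} {m} {n} (hat f x) (hat g y) →
               Σ (S A m) (λ z → Eq {B} {m} {m} (hat πB z) x × Eq {C} {m} {n} (hat πC z) y)
      exists zero n b y fb≈gy =
        let (c , fb≡gc , c≈y)  = atom-preimage g n (f b) y fb≈gy
            (a , πBa≡b , πCa≡c) = mediate b c fb≡gc
        in a , lift πBa≡b , subst (λ c → Eq {C} {zero} {n} c y) (sym πCa≡c) c≈y
      exists (suc m) n (inj₁ x) y (lift e) =
        let (z , πBz≈x , πCz≈y) = exists m n x y e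
        in inj₁ z , lift (Eq-inj₁ʳ m m (hat πB z) x πBz≈x) , lift πCz≈y
      exists (suc m) zero (inj₂ _) y (lift ())
      exists (suc m) (suc n) (inj₂ X) (inj₁ y) (lift e) =
        let (z , πBz≈X , πCz≈y) = exists (suc m) n (inj₂ X) y e
        in z , πBz≈X , Eq-inj₁ʳ (suc m) n (hat πC z) y πCz≈y
      exists (suc m) (suc n) (inj₂ (I , h)) (inj₂ (J , k)) (lift (h⊆k , k⊆h)) =
        inj₂ (I , lifted) ,
        lift ((λ i → i , πB-lifted i) , (λ i → i , πB-lifted i)) ,
        lift ((λ i → partner i , πC-lifted i) , covers)
        where
        partner : I → J
        partner i = proj₁ (h⊆k i)

        mediator : (i : I) → Σ (S A m) (λ z → Eq {B} {m} {m} (hat πB z) (h i) ×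
                                              Eq {C} {m} {n} (hat πC z) (k (partner i)))
        mediator i = exists m n (h i) (k (partner i)) (proj₂ (h⊆k i))

        lifted : I → S A m
        lifted i = proj₁ (mediator i)

        πB-lifted : (i : I) → Eq {B} {m} {m} (hat πB (lifted i)) (h i)
        πB-lifted i = proj₁ (proj₂ (mediator i))

        πC-lifted : (i : I) → Eq {C} {m} {n} (hat πC (lifted i)) (k (partner i))
        πC-lifted i = proj₂ (proj₂ (mediator i))

        -- Every member k j of y is hit: it is a partner of some h i, and by
        -- injectivity of \hat g all partners of h i are equal.
        covers : (j : J) → Σ I (λ i → Eq {C} {m} {n} (hat πC (lifted i)) (k j))
        covers j =
          let (i , fhi≈gkj) = k⊆h j
          in i , Eq-trans m n n (hat πC (lifted i)) (k (partner i)) (k j) (πC-lifted i)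
                   (partner-unique f g g-inj m m n n (h i) (h i) (k (partner i)) (k j)
                     (Eq-refl m (h i)) (proj₂ (h⊆k i)) fhi≈gkj)

lemma3 : {A B C D : Set} (πB : A → B) (πC : A → C) (f₁ : B → D) (g₁ : C → D) →
         IsPullback πB πC f₁ g₁ →
         ((c c' : C) → g₁ c ≡ g₁ c' → c ≡ c') →
         IsPullback∞ πB πC f₁ g₁
lemma3 πB πC f₁ g₁ (comm , mediate , separate) g₁-inj = record
  { commutes = hat-square πB πC f₁ g₁ comm
  ; exists   = exists πB πC f₁ g₁ g₁-inj mediate
  ; unique   = unique πB πC f₁ g₁ g₁-inj comm separate
  }
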